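{- Let $q$ be a prime power, let $n\ge 2k\ge 4$, and let $f$ be a trivial Boolean degree $1$ function on $J_q(n,k)$. Fix a line $\ell$ and a point $a\in\ell$. Suppose that for every $k$-space $K$ containing $a$ we have $f(K)=1$ if $\ell\subseteq K$ and $f(K)=0$ otherwise. Then either $f=p^+$ for some point $p\in\ell\setminus\{a\}$, or $f=p^+\vee\pi^+$ for some point $p\in\ell\setminus\{a\}$ and some hyperplane $\pi$ with $a\notin\pi$ (and $p\notin\pi$).
   Context: $J_q(n,k)$ is the set of all $k$-dimensional subspaces of $\mathbb{F}_q^n$. Points, lines and hyperplanes are the subspaces of dimension $1$, $2$ and $n-1$. A point $p$ lying in a subspace means $p\subseteq$ that subspace. For a point $p$, $p^+(S)=1$ if $p\subseteq S$, else $0$; for a hyperplane $\pi$, $\pi^+(S)=1$ if $S\subseteq\pi$, else $0$; $g^+=g$, $g^-=1-g$ for Boolean $g$; $1^+$ and $1^-$ are the constants $1$ and $0$; $(p^+\vee\pi^+)(S)=1$ iff $p\subseteq S$ or $S\subseteq\pi$. A Boolean degree $1$ function on $J_q(n,k)$ is $f:J_q(n,k)\to\{0,1\}$ of the form $f=c+\sum_p c_p p^+$ (real constants, sum over all points). It is trivial if it is one of $1^\pm$, $p^\pm$, $\pi^\pm$, $(p^+\vee\pi^+)^\pm$ with $p$ a point, $\pi$ a hyperplane and $p\notin\pi$. -}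

module Defs where

open import Level using (0ℓ)
open import Data.Nat using (ℕ; zero; suc; _∸_)
open import Data.Fin using (Fin; zero; suc)
open import Data.Bool using (Bool; true; false)
open import Data.Product using (Σ; ∃; _×_; _,_)
open import Data.Sum using (_⊎_)
open import Relation.Nullary using (¬_)
open import Relation.Binary.PropositionalEquality using (_≡_)
open import Function using (_⇔_)
open import Algebra.Bundles using (CommutativeRing)

-- A finite field with exactly q elements (q is then necessarily a prime power,
-- and every prime power arises this way).  The stdlib has no Field bundle.
record FiniteField (q : ℕ) : Set₁ where
  field
    cring : CommutativeRing 0ℓ 0ℓ
  open CommutativeRing cring public
  field
    1≉0       : ¬ (1# ≈ 0#)
    inverse   : ∀ x → ¬ (x ≈ 0#) → ∃ λ y → x * y ≈ 1#
    enum      : Fin q → Carrier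
    enum-surj : ∀ x → ∃ λ i → enum i ≈ x
    enum-inj  : ∀ i j → enum i ≈ enum j → i ≡ j

module Geometry {q : ℕ} (F : FiniteField q) (n : ℕ) where
  open FiniteField F using (Carrier; _≈_; _+_; _*_; 0#)

  Vec : Set
  Vec = Fin n → Carrier

  sumF : ∀ d → (Fin d → Carrier) → Carrier
  sumF zero    c = 0#
  sumF (suc d) c = c zero + sumF d (λ i → c (suc i))

  lincomb : ∀ {d} → (Fin d → Vec) → (Fin d → Carrier) → Vec
  lincomb {d} b c j = sumF d (λ i → c i * b i j)

  _≈v_ : Vec → Vec → Set
  u ≈v v = ∀ j → u j ≈ v j

  zeroV : Vec
  zeroV j = 0#

  LinIndep : ∀ {d} → (Fin d → Vec) → Set
  LinIndep {d} b = ∀ (c : Fin d → Carrier) → lincomb b c ≈v zeroV → ∀ i → c i ≈ 0#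

  -- a d-dimensional subspace, presented by a basis; it is the span of the basis
  record Sub (d : ℕ) : Set where
    constructor sub
    field
      basis : Fin d → Vec
      indep : LinIndep basis

  _∈_ : ∀ {d} → Vec → Sub d → Set
  v ∈ S = ∃ λ c → v ≈v lincomb (Sub.basis S) c

  _⊆_ : ∀ {d e} → Sub d → Sub e → Set
  S ⊆ T = ∀ v → v ∈ S → v ∈ T

  _≅_ : ∀ {d} → Sub d → Sub d → Set
  S ≅ T = (S ⊆ T) × (T ⊆ S)

  Point Line Hyperplane : Set
  Point      = Sub 1
  Line       = Sub 2
  Hyperplane = Sub (n ∸ 1)

  module _ (k : ℕ) where
    IsPlus : (Sub k → Bool) → (Sub k → Set) → Set
    IsPlus f P = ∀ K → (f K ≡ true) ⇔ P K

    -- f = g⁻ = 1 - g where g is the indicator of P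
    IsMinus : (Sub k → Bool) → (Sub k → Set) → Set
    IsMinus f P = ∀ K → (f K ≡ false) ⇔ P K

    pPlus : Point → Sub k → Set
    pPlus p K = p ⊆ K

    πPlus : Hyperplane → Sub k → Set
    πPlus π K = K ⊆ π

    pπPlus : Point → Hyperplane → Sub k → Set
    pπPlus p π K = (p ⊆ K) ⊎ (K ⊆ π)

    data Trivial (f : Sub k → Bool) : Set where
      one⁺ : (∀ K → f K ≡ true)  → Trivial f
      one⁻ : (∀ K → f K ≡ false) → Trivial f
      pt⁺  : (p : Point) → IsPlus  f (pPlus p) → Trivial f
      pt⁻  : (p : Point) → IsMinus f (pPlus p) → Trivial f
      hy⁺  : (π : Hyperplane) → IsPlus  f (πPlus π) → Trivial f
      hy⁻  : (π : Hyperplane) → IsMinus f (πPlus π) → Trivial f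
      ptHy⁺ : (p : Point) (π : Hyperplane) → ¬ (p ⊆ π) → IsPlus  f (pπPlus p π) → Trivial f
      ptHy⁻ : (p : Point) (π : Hyperplane) → ¬ (p ⊆ π) → IsMinus f (pπPlus p π) → Trivial f

module Submission where

-- The hypothesis fixes f on every k-space through a, and each of the eight kinds
-- of trivial function is tested on a few such spaces.  Write a = ⟨u⟩, ℓ = ⟨w, u⟩, and
-- let x be a vector off ℓ.  Since n ≥ k + 2 there are vectors t, T with x, t, w, u, T
-- independent; then ⟨w, u, T⟩ contains ℓ but not x, while ⟨t, u, T⟩ and ⟨w + t, u, T⟩
-- contain a, miss ℓ and x, and together span w, so every subspace containing both
-- contains ⟨w, u, T⟩.  Inside a hyperplane through a there is also a k-space through a
-- missing ℓ.  These spaces rule out 1^±, p⁻, π^± and (p⁺ ∨ π⁺)⁻, and force p ∈ ℓ \ {a}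
-- (and a ∉ π) in the cases p⁺ and p⁺ ∨ π⁺.

open import Defs
open import Data.Nat using (ℕ; zero; suc; _∸_)
import Data.Nat as ℕ
import Data.Nat.Properties as ℕₚ
open import Data.Fin using (Fin; zero; suc; punchIn; punchOut)
open import Data.Fin.Properties using (all?; any?; ¬∀⟶∃¬; punchIn-punchOut) renaming (_≟_ to _≟ᶠ_)
open import Data.Vec.Functional using ([]; _∷_; tail)
open import Data.Product using (Σ; ∃; _×_; _,_; proj₁; proj₂)
open import Data.Sum using (_⊎_; inj₁; inj₂; [_,_]′)
open import Data.Unit using (⊤; tt)
open import Data.Empty using (⊥; ⊥-elim)
open import Data.Bool using (Bool; true; false)
open import Function using (_∘_; Equivalence)
open import Relation.Nullary using (¬_; Dec; yes; no)
open import Relation.Binary.PropositionalEquality as ≡ using (_≡_)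

module LinearAlgebra {q : ℕ} (F : FiniteField q) where
  open FiniteField F hiding (zero)
  open import Algebra.Properties.Semiring.Sum semiring
    using (sum; sum-cong-≋; sum-replicate-zero; ∑-distrib-+; ∑-comm; *-distribˡ-sum; *-distribʳ-sum)
  open import Algebra.Properties.Ring ring using (-‿distribʳ-*; -1*x≈-x)
  open import Algebra.Properties.Group +-group using (x∙y⁻¹≈ε⇒x≈y; inverseˡ-unique)
  open import Relation.Binary.Reasoning.Setoid setoid

  -- Equality in F is decidable: compare indices in the enumeration of F.
  _≟_ : ∀ x y → Dec (x ≈ y)
  x ≟ y with enum-surj x | enum-surj y
  ... | i , ei | j , ej with i ≟ᶠ j
  ... | yes ≡.refl = yes (trans (sym ei) ej)
  ... | no i≢j = no λ x≈y → i≢j (enum-inj i j (trans ei (trans x≈y (sym ej))))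

  cancel-nonzero : ∀ {x y} → ¬ (x ≈ 0#) → x * y ≈ 0# → y ≈ 0#
  cancel-nonzero {x} {y} x≉0 xy≈0 with inverse x x≉0
  ... | x⁻¹ , xx⁻¹≈1 = begin
    y              ≈⟨ sym (*-identityˡ y) ⟩
    1# * y         ≈⟨ *-congʳ (trans (sym xx⁻¹≈1) (*-comm x x⁻¹)) ⟩
    (x⁻¹ * x) * y  ≈⟨ *-assoc x⁻¹ x y ⟩
    x⁻¹ * (x * y)  ≈⟨ *-congˡ xy≈0 ⟩
    x⁻¹ * 0#       ≈⟨ zeroʳ x⁻¹ ⟩
    0#             ∎

  ≈+⇒-≈ : ∀ {x y z} → x ≈ y + z → x + - y ≈ z
  ≈+⇒-≈ {x} {y} {z} x≈y+z = begin
    x + - y        ≈⟨ +-congʳ (trans x≈y+z (+-comm y z)) ⟩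
    (z + y) + - y  ≈⟨ +-assoc z y (- y) ⟩
    z + (y + - y)  ≈⟨ +-congˡ (-‿inverseʳ y) ⟩
    z + 0#         ≈⟨ +-identityʳ z ⟩
    z              ∎

  -≈⇒≈+ : ∀ {x y z} → x + - y ≈ z → x ≈ y + z
  -≈⇒≈+ {x} {y} {z} x-y≈z = begin
    x              ≈⟨ sym (+-identityʳ x) ⟩
    x + 0#         ≈⟨ +-congˡ (sym (-‿inverseˡ y)) ⟩
    x + (- y + y)  ≈⟨ sym (+-assoc x (- y) y) ⟩
    (x + - y) + y  ≈⟨ +-congʳ x-y≈z ⟩
    z + y          ≈⟨ +-comm z y ⟩
    y + z          ∎

  sum-zero : ∀ {m} {f : Fin m → Carrier} → (∀ i → f i ≈ 0#) → sum f ≈ 0#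
  sum-zero {m} f≈0 = trans (sum-cong-≋ f≈0) (sum-replicate-zero m)

  V : ℕ → Set
  V D = Fin D → Carrier

  lc : ∀ {m D} → (Fin m → V D) → (Fin m → Carrier) → V D
  lc G c j = sum (λ i → c i * G i j)

  infix 4 _∈span_
  record _∈span_ {m D} (v : V D) (G : Fin m → V D) : Set where
    constructor combo
    field
      coeffs : Fin m → Carrier
      equal  : ∀ j → v j ≈ lc G coeffs j

  record Indep {m D} (G : Fin m → V D) : Set where
    constructor indep
    field
      trivial : ∀ c → (∀ j → lc G c j ≈ 0#) → ∀ i → c i ≈ 0#

  module _ {m D} (G : Fin m → V D) where
    lc-cong : ∀ {c c'} → (∀ i → c i ≈ c' i) → ∀ j → lc G c j ≈ lc G c' j
    lc-cong c≈c' j = sum-cong-≋ {m} (λ i → *-congʳ (c≈c' i))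

    lc-zero : ∀ {c} → (∀ i → c i ≈ 0#) → ∀ j → lc G c j ≈ 0#
    lc-zero c≈0 j = sum-zero {m} (λ i → trans (*-congʳ (c≈0 i)) (zeroˡ _))

    lc-+ : ∀ c c' j → lc G (λ i → c i + c' i) j ≈ lc G c j + lc G c' j
    lc-+ c c' j = trans (sum-cong-≋ {m} (λ i → distribʳ _ _ _)) (∑-distrib-+ (λ i → c i * G i j) (λ i → c' i * G i j))

    lc-scale : ∀ x c j → lc G (λ i → x * c i) j ≈ x * lc G c j
    lc-scale x c j = trans (sum-cong-≋ {m} (λ i → *-assoc x (c i) (G i j))) (sym (*-distribˡ-sum x (λ i → c i * G i j)))

    lc-neg : ∀ c j → lc G (λ i → - c i) j ≈ - lc G c j
    lc-neg c j = begin
      lc G (λ i → - c i) j       ≈⟨ lc-cong (λ i → sym (-1*x≈-x (c i))) j ⟩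
      lc G (λ i → - 1# * c i) j  ≈⟨ lc-scale (- 1#) c j ⟩
      - 1# * lc G c j            ≈⟨ -1*x≈-x _ ⟩
      - lc G c j                 ∎

  lc-expand : ∀ {m e D} (B : Fin e → V D) {H : Fin m → V D} (Hc : Fin m → V e) →
              (∀ t j → H t j ≈ lc B (Hc t) j) → ∀ c j → lc H c j ≈ lc B (lc Hc c) j
  lc-expand {m} {e} B {H} Hc H≈ c j = begin
    sum (λ t → c t * H t j)                            ≈⟨ sum-cong-≋ {m} (λ t → *-congˡ (H≈ t j)) ⟩
    sum (λ t → c t * sum (λ i → Hc t i * B i j))       ≈⟨ sum-cong-≋ {m} (λ t → *-distribˡ-sum (c t) (λ i → Hc t i * B i j)) ⟩
    sum (λ t → sum (λ i → c t * (Hc t i * B i j)))     ≈⟨ ∑-comm (λ t i → c t * (Hc t i * B i j)) ⟩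
    sum (λ i → sum (λ t → c t * (Hc t i * B i j)))     ≈⟨ sum-cong-≋ {e} (λ i → sum-cong-≋ {m} (λ t → sym (*-assoc (c t) (Hc t i) (B i j)))) ⟩
    sum (λ i → sum (λ t → (c t * Hc t i) * B i j))     ≈⟨ sum-cong-≋ {e} (λ i → sym (*-distribʳ-sum (B i j) (λ t → c t * Hc t i))) ⟩
    sum (λ i → sum (λ t → c t * Hc t i) * B i j)       ∎

  lc-congᶠ : ∀ {m D} {G G' : Fin m → V D} → (∀ i j → G i j ≈ G' i j) → ∀ c j → lc G c j ≈ lc G' c j
  lc-congᶠ {m} G≈G' c j = sum-cong-≋ {m} (λ i → *-congˡ (G≈G' i j))

  ∈span-tail : ∀ {m D} (G : Fin (suc m) → V D) {v} → v ∈span tail G → v ∈span G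
  ∈span-tail G (combo c v≈) = combo (0# ∷ c) λ j →
    trans (v≈ j) (sym (trans (+-congʳ (zeroˡ (G zero j))) (+-identityˡ _)))

  ∈span-self : ∀ {m D} (G : Fin m → V D) i → G i ∈span G
  ∈span-self G zero = combo (1# ∷ λ _ → 0#) λ j → sym (begin
    1# * G zero j + lc (tail G) (λ _ → 0#) j  ≈⟨ +-cong (*-identityˡ _) (lc-zero (tail G) (λ _ → refl) j) ⟩
    G zero j + 0#                             ≈⟨ +-identityʳ _ ⟩
    G zero j                                  ∎)
  ∈span-self G (suc i) = ∈span-tail G (∈span-self (tail G) i)

  span-trans : ∀ {m e D} {H : Fin m → V D} {G : Fin e → V D} →
               (∀ i → H i ∈span G) → ∀ {v} → v ∈span H → v ∈span G
  span-trans {m} {e} {G = G} H⊆G (combo c v≈) = combo (lc Hc c) λ j →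
    trans (v≈ j) (lc-expand G Hc (_∈span_.equal ∘ H⊆G) c j)
    where
    Hc : Fin m → V e
    Hc = _∈span_.coeffs ∘ H⊆G

  ∈span-≗ : ∀ {m D} {G G' : Fin m → V D} → (∀ i j → G i j ≈ G' i j) → ∀ {v} → v ∈span G → v ∈span G'
  ∈span-≗ G≈G' (combo c v≈) = combo c λ j → trans (v≈ j) (lc-congᶠ G≈G' c j)

  indep-≗ : ∀ {m D} {G G' : Fin m → V D} → (∀ i j → G i j ≈ G' i j) → Indep G → Indep G'
  indep-≗ G≈G' (indep G-indep) = indep λ c rel → G-indep c λ j → trans (lc-congᶠ G≈G' c j) (rel j)

  span-sub : ∀ {m D} {G : Fin m → V D} {z y t : V D} →
             z ∈span G → y ∈span G → (∀ j → z j ≈ y j + t j) → t ∈span G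
  span-sub {G = G} {z} {y} {t} (combo cz z≈) (combo cy y≈) z≈y+t = combo (λ i → cz i + - cy i) λ j → begin
    t j                               ≈⟨ sym (≈+⇒-≈ (z≈y+t j)) ⟩
    z j + - y j                       ≈⟨ +-cong (z≈ j) (-‿cong (y≈ j)) ⟩
    lc G cz j + - lc G cy j           ≈⟨ +-congˡ (sym (lc-neg G cy j)) ⟩
    lc G cz j + lc G (λ i → - cy i) j ≈⟨ sym (lc-+ G cz _ j) ⟩
    lc G (λ i → cz i + - cy i) j      ∎

  span-swap : ∀ {m D} {a b : V D} {R : Fin m → V D} {x} → x ∈span (a ∷ b ∷ R) → x ∈span (b ∷ a ∷ R)
  span-swap {a = a} {b} {R} = span-trans λ
    { zero → ∈span-self (b ∷ a ∷ R) (suc zero)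
    ; (suc zero) → ∈span-self (b ∷ a ∷ R) zero
    ; (suc (suc i)) → ∈span-self (b ∷ a ∷ R) (suc (suc i)) }

  span-insert₂ : ∀ {m D} {s w : V D} {R : Fin m → V D} {x} → x ∈span (s ∷ R) → x ∈span (s ∷ w ∷ R)
  span-insert₂ {s = s} {w} {R} = span-trans λ
    { zero → ∈span-self (s ∷ w ∷ R) zero
    ; (suc i) → ∈span-self (s ∷ w ∷ R) (suc (suc i)) }

  solve-for : ∀ {m D} {v : V D} {H : Fin m → V D} {c₀ c} →
              ¬ (c₀ ≈ 0#) → (∀ j → c₀ * v j + lc H c j ≈ 0#) → v ∈span H
  solve-for {v = v} {H} {c₀} {c} c₀≉0 rel with inverse c₀ c₀≉0
  ... | z , c₀z≈1 = combo (λ i → - (z * c i)) λ j → begin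
    v j                         ≈⟨ sym (*-identityˡ (v j)) ⟩
    1# * v j                    ≈⟨ *-congʳ (trans (sym c₀z≈1) (*-comm c₀ z)) ⟩
    (z * c₀) * v j              ≈⟨ *-assoc z c₀ (v j) ⟩
    z * (c₀ * v j)              ≈⟨ *-congˡ (inverseˡ-unique _ _ (rel j)) ⟩
    z * - lc H c j              ≈⟨ sym (-‿distribʳ-* z _) ⟩
    - (z * lc H c j)            ≈⟨ -‿cong (sym (lc-scale H z c j)) ⟩
    - lc H (λ i → z * c i) j    ≈⟨ sym (lc-neg H _ j) ⟩
    lc H (λ i → - (z * c i)) j  ∎

  exchange : ∀ {m D} {v y : V D} {H : Fin m → V D} → v ∈span (y ∷ H) → ¬ (v ∈span H) → y ∈span (v ∷ H)
  exchange {v = v} {y} {H} (combo c v≈) v∉H with c zero ≟ 0#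
  ... | yes c₀≈0 = ⊥-elim (v∉H (combo (tail c) λ j →
          trans (v≈ j) (trans (+-congʳ (trans (*-congʳ c₀≈0) (zeroˡ (y j)))) (+-identityˡ _))))
  ... | no c₀≉0 = solve-for {H = v ∷ H} {c = - 1# ∷ tail c} c₀≉0 λ j → begin
    c zero * y j + (- 1# * v j + lc H (tail c) j)     ≈⟨ +-congˡ (+-cong (-1*x≈-x (v j)) (sym (≈+⇒-≈ (v≈ j)))) ⟩
    c zero * y j + (- v j + (v j + - (c zero * y j))) ≈⟨ +-congˡ (trans (sym (+-assoc _ _ _)) (+-congʳ (-‿inverseˡ (v j)))) ⟩
    c zero * y j + (0# + - (c zero * y j))            ≈⟨ +-congˡ (+-identityˡ _) ⟩
    c zero * y j + - (c zero * y j)                   ≈⟨ -‿inverseʳ _ ⟩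
    0#                                                ∎

  indep-tail : ∀ {m D} {G : Fin (suc m) → V D} → Indep G → Indep (tail G)
  indep-tail {G = G} (indep G-indep) = indep λ c rel i → G-indep (0# ∷ c)
    (λ j → trans (+-congʳ (zeroˡ (G zero j))) (trans (+-identityˡ _) (rel j))) (suc i)

  indep-head : ∀ {m D} {G : Fin (suc m) → V D} → Indep G → ¬ (G zero ∈span tail G)
  indep-head {G = G} (indep G-indep) (combo c G₀≈) = 1≉0 (G-indep (1# ∷ λ i → - c i) rel zero)
    where
    rel : ∀ j → 1# * G zero j + lc (tail G) (λ i → - c i) j ≈ 0#
    rel j = begin
      1# * G zero j + lc (tail G) (λ i → - c i) j  ≈⟨ +-cong (trans (*-identityˡ _) (G₀≈ j)) (lc-neg (tail G) c j) ⟩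
      lc (tail G) c j + - lc (tail G) c j          ≈⟨ -‿inverseʳ _ ⟩
      0#                                           ∎

  indep-cons : ∀ {m D} {G : Fin (suc m) → V D} → Indep (tail G) → ¬ (G zero ∈span tail G) → Indep G
  indep-cons {G = G} (indep tail-indep) G₀∉ = indep λ c rel → case c rel
    where
    case : ∀ c → (∀ j → lc G c j ≈ 0#) → ∀ i → c i ≈ 0#
    case c rel with c zero ≟ 0#
    ... | no c₀≉0 = ⊥-elim (G₀∉ (solve-for c₀≉0 rel))
    ... | yes c₀≈0 = λ
      { zero → c₀≈0
      ; (suc i) → tail-indep (tail c) (λ j → trans (sym (+-identityˡ _))
          (trans (+-congʳ (sym (trans (*-congʳ c₀≈0) (zeroˡ (G zero j))))) (rel j))) i }

  indep-swap : ∀ {m D} {a b : V D} {R : Fin m → V D} → Indep (a ∷ b ∷ R) → Indep (b ∷ a ∷ R)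
  indep-swap {b = b} {R} abR = indep-cons
    (indep-cons (indep-tail (indep-tail abR)) (λ a∈R → indep-head abR (∈span-tail (b ∷ R) a∈R)))
    (λ b∈aR → indep-head abR (exchange b∈aR (indep-head (indep-tail abR))))

  indep-drop₂ : ∀ {m D} {a b : V D} {R : Fin m → V D} → Indep (a ∷ b ∷ R) → Indep (a ∷ R)
  indep-drop₂ abR = indep-tail (indep-swap abR)

  indep-replace : ∀ {m D} {v x : V D} {H : Fin m → V D} → Indep (v ∷ H) → v ∈span (x ∷ H) → Indep (x ∷ H)
  indep-replace {H = H} vH v∈xH = indep-cons (indep-tail vH) λ x∈H →
    indep-head vH (span-trans (λ { zero → x∈H ; (suc i) → ∈span-self H i }) v∈xH)

  exchange-basis : ∀ {m D} {y u : V D} {R : Fin m → V D} →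
                   Indep (y ∷ R) → u ∈span (y ∷ R) → ¬ (u ∈span R) → Indep (u ∷ R) × y ∈span (u ∷ R)
  exchange-basis yR u∈ u∉ = let y∈ = exchange u∈ u∉ in indep-replace yR y∈ , y∈

  -- Over a finite field, membership in a span is decidable (try every head coefficient).
  span? : ∀ {m D} (G : Fin m → V D) v → Dec (v ∈span G)
  span? {zero} G v with all? (λ j → v j ≟ 0#)
  ... | yes v≈0 = yes (combo (λ ()) v≈0)
  ... | no v≉0 = no λ (combo _ v≈0) → v≉0 v≈0
  span? {suc m} G v with any? (λ i → span? (tail G) (λ j → v j + - (enum i * G zero j)))
  ... | yes (i , combo c rest) = yes (combo (enum i ∷ c) λ j → -≈⇒≈+ (rest j))
  ... | no none = no λ (combo c v≈) → let (i , eᵢ≈c₀) = enum-surj (c zero) in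
        none (i , combo (tail c) λ j → ≈+⇒-≈ (trans (v≈ j) (+-congʳ (*-congʳ (sym eᵢ≈c₀)))))

  complete-pair : ∀ {D} {y z u : V D} → Indep (y ∷ z ∷ []) → ¬ (u ∈span []) → u ∈span (y ∷ z ∷ []) →
                  Σ (V D) λ w → Indep (w ∷ u ∷ []) × w ∈span (y ∷ z ∷ [])
                              × (∀ i → (y ∷ z ∷ []) i ∈span (w ∷ u ∷ []))
  complete-pair {y = y} {z} {u} yz u≠0 u∈ with span? (z ∷ []) u
  ... | no u∉z = let (uz , y∈) = exchange-basis yz u∈ u∉z in
    z , indep-swap uz , ∈span-self (y ∷ z ∷ []) (suc zero) ,
    λ { zero → span-swap y∈ ; (suc zero) → ∈span-self (z ∷ u ∷ []) zero }
  ... | yes u∈z = let (uy , z∈) = exchange-basis (indep-swap yz) (span-swap u∈) u∉y in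
    y , indep-swap uy , ∈span-self (y ∷ z ∷ []) zero ,
    λ { zero → ∈span-self (y ∷ u ∷ []) zero ; (suc zero) → span-swap z∈ }
    where
    -- u ∈ span z forces z ∈ span u; so u ∈ span y would put z ∈ span y.
    u∉y : ¬ (u ∈span (y ∷ []))
    u∉y u∈y = indep-head (indep-swap yz) (span-trans (λ { zero → u∈y ; (suc ()) }) (exchange u∈z u≠0))

  -- Fresh vectors: fewer than D vectors of F^D never span F^D.  Proof by Gaussian
  -- elimination on the first coordinate.
  e₀ : ∀ {D} → V (suc D)
  e₀ = 1# ∷ λ _ → 0#

  e₀-fresh : ∀ {m D} (H : Fin m → V (suc D)) → (∀ i → H i zero ≈ 0#) → ¬ (e₀ ∈span H)
  e₀-fresh {m} H H₀≈0 (combo c e₀≈) =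
    1≉0 (trans (e₀≈ zero) (sum-zero {m} (λ i → trans (*-congˡ (H₀≈0 i)) (zeroʳ (c i)))))

  -- One elimination step with pivot p = H j, where p₀ ≠ 0: subtracting rᵢ p from the
  -- other vectors clears their coordinate 0, leaving the family H' in F^D; a vector v'
  -- outside span H' gives the vector (0, v') outside span H.
  module Elimination {m D} (H : Fin (suc m) → V (suc D)) (j : Fin (suc m)) (p₀≉0 : ¬ (H j zero ≈ 0#)) where
    p : V (suc D)
    p = H j

    p₀⁻¹ : Carrier
    p₀⁻¹ = proj₁ (inverse (p zero) p₀≉0)

    r : Fin m → Carrier
    r i = H (punchIn j i) zero * p₀⁻¹

    H' : Fin m → V D
    H' i t = H (punchIn j i) (suc t) + - (r i * p (suc t))

    E : Fin m → V (suc D)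
    E i = 0# ∷ H' i

    split : ∀ i k → H (punchIn j i) k ≈ r i * p k + E i k
    split i zero = sym (begin
      (h * p₀⁻¹) * p zero + 0#  ≈⟨ +-identityʳ _ ⟩
      (h * p₀⁻¹) * p zero       ≈⟨ *-assoc h p₀⁻¹ (p zero) ⟩
      h * (p₀⁻¹ * p zero)       ≈⟨ *-congˡ (trans (*-comm p₀⁻¹ (p zero)) (proj₂ (inverse (p zero) p₀≉0))) ⟩
      h * 1#                    ≈⟨ *-identityʳ h ⟩
      h                         ∎)
      where
      h : Carrier
      h = H (punchIn j i) zero
    split i (suc t) = -≈⇒≈+ refl

    H⊆pE : ∀ i → H i ∈span (p ∷ E)
    H⊆pE i with j ≟ᶠ i
    ... | yes ≡.refl = ∈span-self (p ∷ E) zero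
    ... | no j≢i = ≡.subst (λ k → H k ∈span (p ∷ E)) (punchIn-punchOut j≢i) (other (punchOut j≢i))
      where
      other : ∀ t → H (punchIn j t) ∈span (p ∷ E)
      other t with ∈span-self E t
      ... | combo c Eₜ≈ = combo (r t ∷ c) λ k → trans (split t k) (+-congˡ (Eₜ≈ k))

    reduce : ∀ {v'} → ¬ (v' ∈span H') → ¬ ((0# ∷ v') ∈span H)
    reduce {v'} v'∉ v∈H with span-trans H⊆pE v∈H
    ... | combo c v≈ = v'∉ (combo (tail c) λ t → begin
      v' t                                  ≈⟨ v≈ (suc t) ⟩
      c zero * p (suc t) + lc H' (tail c) t ≈⟨ +-congʳ (trans (*-congʳ c₀≈0) (zeroˡ _)) ⟩
      0# + lc H' (tail c) t                 ≈⟨ +-identityˡ _ ⟩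
      lc H' (tail c) t                      ∎)
      where
      c₀≈0 : c zero ≈ 0#
      c₀≈0 = cancel-nonzero p₀≉0 (trans (*-comm (p zero) (c zero)) (sym (begin
        0#                                   ≈⟨ v≈ zero ⟩
        c zero * p zero + lc E (tail c) zero ≈⟨ +-congˡ (sum-zero {m} (λ i → zeroʳ (c (suc i)))) ⟩
        c zero * p zero + 0#                 ≈⟨ +-identityʳ _ ⟩
        c zero * p zero                      ∎)))

  fresh-vector : ∀ {m D} → m ℕ.< D → (H : Fin m → V D) → ∃ λ v → ¬ (v ∈span H)
  fresh-vector {zero}  {suc D} _ H = e₀ , e₀-fresh H (λ ())
  fresh-vector {suc m} {suc D} (ℕ.s≤s m<D) H with all? (λ i → H i zero ≟ 0#)
  ... | yes H₀≈0 = e₀ , e₀-fresh H H₀≈0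
  ... | no ¬H₀≈0 with ¬∀⟶∃¬ (suc m) _ (λ i → H i zero ≟ 0#) ¬H₀≈0
  ...   | j , pivot with fresh-vector m<D (Elimination.H' H j pivot)
  ...     | v' , v'∉ = (0# ∷ v') , Elimination.reduce H j pivot v'∉

  coords-unique : ∀ {m D} {B : Fin m → V D} → Indep B → ∀ {c c'} →
                  (∀ j → lc B c j ≈ lc B c' j) → ∀ i → c i ≈ c' i
  coords-unique {B = B} (indep B-indep) {c} {c'} same i = x∙y⁻¹≈ε⇒x≈y _ _ (B-indep _ rel i)
    where
    rel : ∀ j → lc B (λ i → c i + - c' i) j ≈ 0#
    rel j = begin
      lc B (λ i → c i + - c' i) j      ≈⟨ lc-+ B c _ j ⟩
      lc B c j + lc B (λ i → - c' i) j ≈⟨ +-cong (same j) (lc-neg B c' j) ⟩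
      lc B c' j + - lc B c' j          ≈⟨ -‿inverseʳ _ ⟩
      0#                               ∎

  -- A region U "of dimension N": any fewer than N of its vectors leave out some vector of U.
  FreshSupply : ∀ {D} → (V D → Set) → ℕ → Set
  FreshSupply {D} U N = ∀ {s} (H : Fin s → V D) → s ℕ.< N → (∀ i → U (H i)) → ∃ λ v → U v × ¬ (v ∈span H)

  whole-space : ∀ {D} → FreshSupply {D} (λ _ → ⊤) D
  whole-space H s<D _ = let (v , v∉) = fresh-vector s<D H in v , tt , v∉

  -- The span of e independent vectors is a region of dimension e: pass to coordinates.
  within-span : ∀ {e D} {B : Fin e → V D} → Indep B → FreshSupply (_∈span B) e
  within-span {e} {B = B} B-indep {s} H s<e H⊆B = let (vc , vc∉) = fresh-vector s<e Hc in
    lc B vc , combo vc (λ j → refl) , λ (combo c v≈) →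
      vc∉ (combo c (coords-unique B-indep λ j → trans (v≈ j) (lc-expand B Hc (_∈span_.equal ∘ H⊆B) c j)))
    where
    Hc : Fin s → V e
    Hc = _∈span_.coeffs ∘ H⊆B

  -- Concatenation of families, by recursion on the prefix so that concrete prefixes
  -- compute: (x ∷ y ∷ []) ++ T reduces to x ∷ y ∷ T.
  infixr 5 _++_
  _++_ : ∀ {A : Set} {m r} → (Fin m → A) → (Fin r → A) → Fin (m ℕ.+ r) → A
  _++_ {m = zero}  P T = T
  _++_ {m = suc m} P T = P zero ∷ (tail P ++ T)

  ++-all : ∀ {A : Set} {U : A → Set} {m r} (P : Fin m → A) (T : Fin r → A) →
           (∀ i → U (P i)) → (∀ i → U (T i)) → ∀ i → U ((P ++ T) i)
  ++-all {m = zero}  P T UP UT i       = UT i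
  ++-all {m = suc m} P T UP UT zero    = UP zero
  ++-all {U = U} {m = suc m} P T UP UT (suc i) = ++-all {U = U} (tail P) T (UP ∘ suc) UT i

  ++[]-⊆ : ∀ {m D} (P : Fin m → V D) i → (P ++ []) i ∈span P
  ++[]-⊆ {suc m} P zero    = ∈span-self P zero
  ++[]-⊆ {suc m} P (suc i) = ∈span-tail P (++[]-⊆ (tail P) i)

  indep-++[] : ∀ {m D} {P : Fin m → V D} → Indep P → Indep (P ++ [])
  indep-++[] {zero}          _     = indep λ _ _ ()
  indep-++[] {suc m} {P = P} P-ind = indep-cons (indep-++[] (indep-tail P-ind)) λ P₀∈ →
    indep-head P-ind (span-trans (++[]-⊆ (tail P)) P₀∈)

  moved-⊆ : ∀ {m r D} (P : Fin m → V D) (v : V D) (T : Fin r → V D) i → (P ++ (v ∷ T)) i ∈span (v ∷ (P ++ T))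
  moved-⊆ {zero}  P v T i       = ∈span-self (v ∷ T) i
  moved-⊆ {suc m} P v T zero    = ∈span-self (v ∷ (P ++ T)) (suc zero)
  moved-⊆ {suc m} P v T (suc i) = span-insert₂ (moved-⊆ (tail P) v T i)

  indep-move : ∀ {m r D} (P : Fin m → V D) {v : V D} {T : Fin r → V D} →
               Indep (v ∷ (P ++ T)) → Indep (P ++ (v ∷ T))
  indep-move {zero}  P vPT = vPT
  indep-move {suc m} P {v} {T} vPT = indep-cons (indep-move (tail P) (indep-tail swapped)) λ P₀∈ →
    indep-head swapped (span-trans (moved-⊆ (tail P) _ _) P₀∈)
    where
    swapped : Indep (P zero ∷ v ∷ (tail P ++ T))
    swapped = indep-swap vPT

  extend : ∀ {D N} {U : V D → Set} → FreshSupply U N → ∀ {m} r (P : Fin m → V D) →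
           Indep P → (∀ i → U (P i)) → m ℕ.+ r ℕ.≤ N →
           Σ (Fin r → V D) λ T → Indep (P ++ T) × (∀ i → U (T i))
  extend fresh zero P P-ind UP _ = [] , indep-++[] P-ind , λ ()
  extend {U = U} fresh {m} (suc r) P P-ind UP m+r<N
    with extend fresh r P P-ind UP (ℕₚ.≤-trans (ℕₚ.+-monoʳ-≤ m (ℕₚ.n≤1+n r)) m+r<N)
  ... | T , PT-ind , UT
    with fresh (P ++ T) (ℕₚ.≤-trans (ℕₚ.≤-reflexive (≡.sym (ℕₚ.+-suc m r))) m+r<N) (++-all {U = U} P T UP UT)
  ...   | v , Uv , v∉ = (v ∷ T) , indep-move P (indep-cons PT-ind v∉) , λ { zero → Uv ; (suc i) → UT i }

module Subspaces {q : ℕ} (F : FiniteField q) (n : ℕ) where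
  open FiniteField F using (Carrier; _≈_; _+_; _*_; refl; sym; trans; reflexive)
  open import Algebra.Properties.Semiring.Sum (FiniteField.semiring F) using (sum)
  open LinearAlgebra F
  open Geometry F n

  sumF≡sum : ∀ d (f : Fin d → Carrier) → sumF d f ≡ sum f
  sumF≡sum zero    f = ≡.refl
  sumF≡sum (suc d) f = ≡.cong (f zero +_) (sumF≡sum d (tail f))

  lincomb≈lc : ∀ {d} (b : Fin d → V n) c j → lincomb b c j ≈ lc b c j
  lincomb≈lc {d} b c j = reflexive (sumF≡sum d (λ i → c i * b i j))

  ∈⇒∈span : ∀ {d} {S : Sub d} {v} → v ∈ S → v ∈span Sub.basis S
  ∈⇒∈span {S = S} (c , v≈) = combo c λ j → trans (v≈ j) (lincomb≈lc (Sub.basis S) c j)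

  ∈span⇒∈ : ∀ {d} {S : Sub d} {v} → v ∈span Sub.basis S → v ∈ S
  ∈span⇒∈ {S = S} (combo c v≈) = c , λ j → trans (v≈ j) (sym (lincomb≈lc (Sub.basis S) c j))

  basis-indep : ∀ {d} (S : Sub d) → Indep (Sub.basis S)
  basis-indep S = indep λ c rel → Sub.indep S c λ j → trans (lincomb≈lc (Sub.basis S) c j) (rel j)

  spanned : ∀ {d} (b : Fin d → V n) → Indep b → Sub d
  spanned b (indep b-indep) = sub b λ c rel → b-indep c λ j → trans (sym (lincomb≈lc b c j)) (rel j)

  ⊆-intro : ∀ {d e} {S : Sub d} {T : Sub e} → (∀ i → Sub.basis S i ∈span Sub.basis T) → S ⊆ T
  ⊆-intro {S = S} {T} S⊆T v v∈S = ∈span⇒∈ {S = T} (span-trans S⊆T (∈⇒∈span {S = S} v∈S))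

  ⊆-elim : ∀ {d e} {S : Sub d} {T : Sub e} → S ⊆ T → ∀ {v} → v ∈span Sub.basis S → v ∈span Sub.basis T
  ⊆-elim {S = S} {T} S⊆T v∈S = ∈⇒∈span {S = T} (S⊆T _ (∈span⇒∈ {S = S} v∈S))

  ⊆-trans : ∀ {d e g} {S : Sub d} {T : Sub e} {U : Sub g} → S ⊆ T → T ⊆ U → S ⊆ U
  ⊆-trans S⊆T T⊆U v v∈S = T⊆U v (S⊆T v v∈S)

  vec : Point → V n
  vec p = Sub.basis p zero

  point-⊆ : ∀ {d} (p : Point) {S : Sub d} → vec p ∈span Sub.basis S → p ⊆ S
  point-⊆ p {S} p∈S = ⊆-intro {S = p} {S} λ { zero → p∈S }

  ⊆-point : ∀ {d} (p : Point) {S : Sub d} → p ⊆ S → vec p ∈span Sub.basis S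
  ⊆-point p {S} p⊆S = ⊆-elim {S = p} {S} p⊆S (∈span-self (Sub.basis p) zero)

  vec-nonzero : (p : Point) → ¬ (vec p ∈span [])
  vec-nonzero p p∈ = indep-head (basis-indep p) (∈span-≗ (λ ()) p∈)

-- The configuration of the theorem: a line ℓ, a point a on it, and k = k' + 2 with
-- k + 2 ≤ n (which follows from n ≥ 2k ≥ 4).  We construct the k-spaces the proof
-- tests f on.
module Configuration {q : ℕ} (F : FiniteField q) (n k' : ℕ) (room : 4 ℕ.+ k' ℕ.≤ n)
                     (ℓ : Geometry.Line F n) (a : Geometry.Point F n) (a⊆ℓ : Geometry._⊆_ F n a ℓ) where
  open FiniteField F using (_≈_; _+_; refl; +-comm)
  open LinearAlgebra F
  open Geometry F n
  open Subspaces F n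

  k : ℕ
  k = suc (suc k')

  u : V n
  u = vec a

  u-indep : Indep (u ∷ [])
  u-indep = indep-≗ (λ { zero j → refl }) (basis-indep a)

  private
    ℓ₀ ℓ₁ : V n
    ℓ₀ = Sub.basis ℓ zero
    ℓ₁ = Sub.basis ℓ (suc zero)

    ℓ≗ : ∀ i j → Sub.basis ℓ i j ≈ (ℓ₀ ∷ ℓ₁ ∷ []) i j
    ℓ≗ zero       j = refl
    ℓ≗ (suc zero) j = refl

    ℓ≗' : ∀ i j → (ℓ₀ ∷ ℓ₁ ∷ []) i j ≈ Sub.basis ℓ i j
    ℓ≗' zero       j = refl
    ℓ≗' (suc zero) j = refl

    second : Σ (V n) λ w → Indep (w ∷ u ∷ []) × w ∈span (ℓ₀ ∷ ℓ₁ ∷ [])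
                         × (∀ i → (ℓ₀ ∷ ℓ₁ ∷ []) i ∈span (w ∷ u ∷ []))
    second = complete-pair (indep-≗ ℓ≗ (basis-indep ℓ)) (vec-nonzero a) (∈span-≗ ℓ≗ (⊆-point a {ℓ} a⊆ℓ))

  w : V n
  w = proj₁ second

  wu-indep : Indep (w ∷ u ∷ [])
  wu-indep = proj₁ (proj₂ second)

  w∈ℓ : w ∈span Sub.basis ℓ
  w∈ℓ = ∈span-≗ ℓ≗' (proj₁ (proj₂ (proj₂ second)))

  u∈ℓ : u ∈span Sub.basis ℓ
  u∈ℓ = ⊆-point a {ℓ} a⊆ℓ

  ℓ⊆wu : ∀ i → Sub.basis ℓ i ∈span (w ∷ u ∷ [])
  ℓ⊆wu zero       = proj₂ (proj₂ (proj₂ second)) zero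
  ℓ⊆wu (suc zero) = proj₂ (proj₂ (proj₂ second)) (suc zero)

  ℓ⊆-intro : ∀ {d} {K : Sub d} → w ∈span Sub.basis K → u ∈span Sub.basis K → ℓ ⊆ K
  ℓ⊆-intro {K = K} w∈K u∈K = ⊆-intro {S = ℓ} {K} λ i →
    span-trans {H = w ∷ u ∷ []} (λ { zero → w∈K ; (suc zero) → u∈K }) (ℓ⊆wu i)

  ℓ⊈-intro : ∀ {d} {K : Sub d} → ¬ (w ∈span Sub.basis K) → ¬ (ℓ ⊆ K)
  ℓ⊈-intro {K = K} w∉K ℓ⊆K = w∉K (⊆-elim {S = ℓ} {K} ℓ⊆K w∈ℓ)

  off-ℓ⇒off-wu : ∀ {x} → ¬ (x ∈span Sub.basis ℓ) → ¬ (x ∈span (w ∷ u ∷ []))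
  off-ℓ⇒off-wu x∉ℓ x∈ = x∉ℓ (span-trans {H = w ∷ u ∷ []} (λ { zero → w∈ℓ ; (suc zero) → u∈ℓ }) x∈)

  off-line : ∃ λ x → ¬ (x ∈span Sub.basis ℓ)
  off-line = fresh-vector (ℕₚ.≤-trans (ℕ.s≤s (ℕ.s≤s (ℕ.s≤s ℕ.z≤n))) room) (Sub.basis ℓ)

  -- For a vector x off ℓ: extend (x, w, u) to an independent family t, x, w, u, T of
  -- k + 2 vectors and put R = u ∷ T.  Then Kℓ = ⟨w, R⟩ contains ℓ but not x, while
  -- K₁ = ⟨t, R⟩ and K₂ = ⟨w + t, R⟩ contain a but neither ℓ nor x, and every subspace
  -- containing K₁ and K₂ contains w = (w + t) - t, hence Kℓ.
  module Frame (x : V n) (x∉ℓ : ¬ (x ∈span Sub.basis ℓ)) where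
    private
      extended : Σ (Fin k' → V n) λ T → Indep (x ∷ w ∷ u ∷ T) × (∀ i → ⊤)
      extended = extend whole-space k' (x ∷ w ∷ u ∷ []) (indep-cons wu-indep (off-ℓ⇒off-wu x∉ℓ)) (λ _ → tt)
                        (ℕₚ.≤-trans (ℕₚ.n≤1+n _) room)

      R : Fin (suc k') → V n
      R = u ∷ proj₁ extended

      xwR : Indep (x ∷ w ∷ R)
      xwR = proj₁ (proj₂ extended)

      t : V n
      t = proj₁ (fresh-vector room (x ∷ w ∷ R))

      txwR : Indep (t ∷ x ∷ w ∷ R)
      txwR = indep-cons xwR (proj₂ (fresh-vector room (x ∷ w ∷ R)))

      w+t : V n
      w+t j = w j + t j

      sxwR : Indep (w+t ∷ x ∷ w ∷ R)
      sxwR = indep-replace txwR (span-sub (∈span-self (w+t ∷ x ∷ w ∷ R) zero)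
                                          (∈span-self (w+t ∷ x ∷ w ∷ R) (suc (suc zero))) (λ j → refl))

    Kℓ : Sub k
    Kℓ = spanned (w ∷ R) (indep-tail xwR)

    ℓ⊆Kℓ : ℓ ⊆ Kℓ
    ℓ⊆Kℓ = ℓ⊆-intro {K = Kℓ} (∈span-self (w ∷ R) zero) (∈span-self (w ∷ R) (suc zero))

    x∉Kℓ : ¬ (x ∈span Sub.basis Kℓ)
    x∉Kℓ = indep-head xwR

    K[_] : ∀ {s} → Indep (s ∷ x ∷ w ∷ R) → Sub k
    K[_] {s} sxwR' = spanned (s ∷ R) (indep-drop₂ (indep-drop₂ sxwR'))

    a⊆K : ∀ {s} (h : Indep (s ∷ x ∷ w ∷ R)) → a ⊆ K[ h ]
    a⊆K {s} h = point-⊆ a {K[ h ]} (∈span-self (s ∷ R) (suc zero))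

    ℓ⊈K : ∀ {s} (h : Indep (s ∷ x ∷ w ∷ R)) → ¬ (ℓ ⊆ K[ h ])
    ℓ⊈K h = ℓ⊈-intro {K = K[ h ]} (indep-head (indep-swap (indep-drop₂ h)))

    x∉K : ∀ {s} (h : Indep (s ∷ x ∷ w ∷ R)) → ¬ (x ∈span Sub.basis K[ h ])
    x∉K h x∈ = indep-head (indep-swap h) (span-insert₂ x∈)

    K₁ K₂ : Sub k
    K₁ = K[ txwR ]
    K₂ = K[ sxwR ]

    K₁-avoids : a ⊆ K₁ × ¬ (ℓ ⊆ K₁) × ¬ (x ∈span Sub.basis K₁)
    K₁-avoids = a⊆K txwR , ℓ⊈K txwR , x∉K txwR

    K₂-avoids : a ⊆ K₂ × ¬ (ℓ ⊆ K₂) × ¬ (x ∈span Sub.basis K₂)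
    K₂-avoids = a⊆K sxwR , ℓ⊈K sxwR , x∉K sxwR

    covers : ∀ {e} (π : Sub e) → K₁ ⊆ π → K₂ ⊆ π → Kℓ ⊆ π
    covers π K₁⊆π K₂⊆π = ⊆-intro {S = Kℓ} {π} λ
      { zero → span-sub (in₂ zero) (in₁ zero) (λ j → +-comm (w j) (t j))
      ; (suc i) → in₁ (suc i) }
      where
      in₁ : ∀ i → (t ∷ R) i ∈span Sub.basis π
      in₁ i = ⊆-elim {S = K₁} {π} K₁⊆π (∈span-self (t ∷ R) i)
      in₂ : ∀ i → (w+t ∷ R) i ∈span Sub.basis π
      in₂ i = ⊆-elim {S = K₂} {π} K₂⊆π (∈span-self (w+t ∷ R) i)

  through-ℓ-avoiding : ∀ {x} → ¬ (x ∈span Sub.basis ℓ) → Σ (Sub k) λ K → ℓ ⊆ K × ¬ (x ∈span Sub.basis K)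
  through-ℓ-avoiding x∉ℓ = Kℓ , ℓ⊆Kℓ , x∉Kℓ
    where open Frame _ x∉ℓ

  through-a-avoiding : ∀ {x} → ¬ (x ∈span Sub.basis ℓ) →
                       Σ (Sub k) λ K → a ⊆ K × ¬ (ℓ ⊆ K) × ¬ (x ∈span Sub.basis K)
  through-a-avoiding x∉ℓ = K₁ , K₁-avoids
    where open Frame _ x∉ℓ

  covering : ∀ {x} → ¬ (x ∈span Sub.basis ℓ) → ∀ {e} (π : Sub e) →
             (∀ K → a ⊆ K → ¬ (ℓ ⊆ K) → ¬ (x ∈span Sub.basis K) → K ⊆ π) → Σ (Sub k) λ K → ℓ ⊆ K × K ⊆ π
  covering {x} x∉ℓ π contains = Kℓ , ℓ⊆Kℓ , covers π (avoiding⊆π K₁ K₁-avoids) (avoiding⊆π K₂ K₂-avoids)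
    where
    open Frame x x∉ℓ
    avoiding⊆π : ∀ K → a ⊆ K × ¬ (ℓ ⊆ K) × ¬ (x ∈span Sub.basis K) → K ⊆ π
    avoiding⊆π K (a⊆K , ℓ⊈K , x∉K) = contains K a⊆K ℓ⊈K x∉K

  -- A point lying in every k-space through ℓ, or in every k-space through a missing ℓ,
  -- lies on ℓ: otherwise the k-spaces above avoid it.
  on-ℓ : (p : Point) → (∀ K → ℓ ⊆ K → p ⊆ K) → p ⊆ ℓ
  on-ℓ p forced with span? (Sub.basis ℓ) (vec p)
  ... | yes p∈ℓ = point-⊆ p {ℓ} p∈ℓ
  ... | no p∉ℓ = let (K , ℓ⊆K , p∉K) = through-ℓ-avoiding p∉ℓ in ⊥-elim (p∉K (⊆-point p {K} (forced K ℓ⊆K)))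

  on-ℓ′ : (p : Point) → (∀ K → a ⊆ K → ¬ (ℓ ⊆ K) → p ⊆ K) → p ⊆ ℓ
  on-ℓ′ p forced with span? (Sub.basis ℓ) (vec p)
  ... | yes p∈ℓ = point-⊆ p {ℓ} p∈ℓ
  ... | no p∉ℓ = let (K , a⊆K , ℓ⊈K , p∉K) = through-a-avoiding p∉ℓ in
    ⊥-elim (p∉K (⊆-point p {K} (forced K a⊆K ℓ⊈K)))

  -- Inside a hyperplane π through a there is a k-space through a missing ℓ: extend u
  -- inside π (a region of dimension n - 1) to ⟨u, T⟩ avoiding w.  If w ∈ π, extend
  -- (w, u) and drop w; if w ∉ π, any extension avoids w.
  module InHyperplane (π : Hyperplane) (a⊆π : a ⊆ π) where
    B : Fin (n ∸ 1) → V n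
    B = Sub.basis π

    inside : FreshSupply (_∈span B) (n ∸ 1)
    inside = within-span (basis-indep π)

    u∈π : u ∈span B
    u∈π = ⊆-point a {π} a⊆π

    uT⊆π : ∀ {T : Fin (suc k') → V n} → (∀ i → T i ∈span B) → ∀ i → (u ∷ T) i ∈span B
    uT⊆π T⊆π zero    = u∈π
    uT⊆π T⊆π (suc i) = T⊆π i

    ⟨u,_⟩ : ∀ T → Indep (u ∷ T) → (∀ i → T i ∈span B) → ¬ (w ∈span (u ∷ T)) →
            Σ (Sub k) λ K → a ⊆ K × ¬ (ℓ ⊆ K) × K ⊆ π
    ⟨u, T ⟩ uT T⊆π w∉ = K , point-⊆ a {K} (∈span-self (u ∷ T) zero) , ℓ⊈-intro {K = K} w∉ ,
                         ⊆-intro {S = K} {π} (uT⊆π T⊆π)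
      where
      K : Sub k
      K = spanned (u ∷ T) uT

    avoiding-space : Dec (w ∈span B) → Σ (Sub k) λ K → a ⊆ K × ¬ (ℓ ⊆ K) × K ⊆ π
    avoiding-space (yes w∈π) =
      let (T , wuT , T⊆π) = extend inside (suc k') (w ∷ u ∷ []) wu-indep
                                   (λ { zero → w∈π ; (suc zero) → u∈π }) (ℕₚ.∸-monoˡ-≤ 1 room)
      in ⟨u, T ⟩ (indep-tail wuT) T⊆π (indep-head wuT)
    avoiding-space (no w∉π) =
      let (T , uT , T⊆π) = extend inside (suc k') (u ∷ []) u-indep (λ { zero → u∈π })
                                  (ℕₚ.≤-trans (ℕₚ.n≤1+n _) (ℕₚ.∸-monoˡ-≤ 1 room))
      in ⟨u, T ⟩ uT T⊆π (λ w∈uT → w∉π (span-trans (uT⊆π T⊆π) w∈uT))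

  avoid-in : (π : Hyperplane) → a ⊆ π → Σ (Sub k) λ K → a ⊆ K × ¬ (ℓ ⊆ K) × K ⊆ π
  avoid-in π a⊆π = avoiding-space (span? B w)
    where open InHyperplane π a⊆π

module Classification {q : ℕ} (F : FiniteField q) (n k' : ℕ) (room : 4 ℕ.+ k' ℕ.≤ n)
                      (ℓ : Geometry.Line F n) (a : Geometry.Point F n) (a⊆ℓ : Geometry._⊆_ F n a ℓ)
                      (f : Geometry.Sub F n (suc (suc k')) → Bool)
                      (hyp : ∀ K → Geometry._⊆_ F n a K →
                             (Geometry._⊆_ F n ℓ K → f K ≡ true) × (¬ Geometry._⊆_ F n ℓ K → f K ≡ false)) where
  open LinearAlgebra F using (_∈span_)
  open Geometry F n
  open Subspaces F n
  open Configuration F n k' room ℓ a a⊆ℓ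
  open Equivalence

  through-a : ∀ (K : Sub k) → ℓ ⊆ K → a ⊆ K
  through-a K ℓ⊆K = ⊆-trans {S = a} {ℓ} {K} a⊆ℓ ℓ⊆K

  on : ∀ K → ℓ ⊆ K → f K ≡ true
  on K ℓ⊆K = proj₁ (hyp K (through-a K ℓ⊆K)) ℓ⊆K

  off : ∀ K → a ⊆ K → ¬ (ℓ ⊆ K) → f K ≡ false
  off K a⊆K = proj₂ (hyp K a⊆K)

  clash : ∀ {K} → f K ≡ true → f K ≡ false → ⊥
  clash fK≡true fK≡false with ≡.trans (≡.sym fK≡true) fK≡false
  ... | ()

  K⁺ : Σ (Sub k) λ K → ℓ ⊆ K
  K⁺ = let (K , ℓ⊆K , _) = through-ℓ-avoiding (proj₂ off-line) in K , ℓ⊆K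

  K⁻ : Σ (Sub k) λ K → a ⊆ K × ¬ (ℓ ⊆ K)
  K⁻ = let (K , a⊆K , ℓ⊈K , _) = through-a-avoiding (proj₂ off-line) in K , a⊆K , ℓ⊈K

  distinct-from-a : (p : Point) → (∀ K → p ⊆ K → f K ≡ true) → ¬ (p ≅ a)
  distinct-from-a p forced (p⊆a , _) = let (K , a⊆K , ℓ⊈K) = K⁻ in
    clash (forced K (⊆-trans {S = p} {a} {K} p⊆a a⊆K)) (off K a⊆K ℓ⊈K)

  off-ℓ : (p : Point) → (∀ K → p ⊆ K → f K ≡ false) → ¬ (p ⊆ ℓ)
  off-ℓ p forced p⊆ℓ = let (K , ℓ⊆K) = K⁺ in clash (on K ℓ⊆K) (forced K (⊆-trans {S = p} {ℓ} {K} p⊆ℓ ℓ⊆K))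

  a∉ : (π : Hyperplane) → (∀ K → K ⊆ π → f K ≡ true) → ¬ (a ⊆ π)
  a∉ π forced a⊆π = let (K , a⊆K , ℓ⊈K , K⊆π) = avoid-in π a⊆π in clash (forced K K⊆π) (off K a⊆K ℓ⊈K)

  -- f cannot vanish on every k-space inside π if π contains all k-spaces through a that
  -- miss ℓ and some vector x off ℓ: π then contains a k-space through ℓ.
  not-covered : ∀ {x} → ¬ (x ∈span Sub.basis ℓ) → (π : Hyperplane) → (∀ K → K ⊆ π → f K ≡ false) →
                (∀ K → a ⊆ K → ¬ (ℓ ⊆ K) → ¬ (x ∈span Sub.basis K) → K ⊆ π) → ⊥
  not-covered x∉ℓ π forced contains = let (K , ℓ⊆K , K⊆π) = covering x∉ℓ π contains in
    clash (on K ℓ⊆K) (forced K K⊆π)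

  classify : Trivial k f →
             (Σ Point λ p → (p ⊆ ℓ) × ¬ (p ≅ a) × IsPlus k f (pPlus k p))
             ⊎ (Σ Point λ p → Σ Hyperplane λ π → (p ⊆ ℓ) × ¬ (p ≅ a) × ¬ (a ⊆ π) × ¬ (p ⊆ π)
                 × IsPlus k f (pπPlus k p π))
  classify (one⁺ f≡1) = let (K , a⊆K , ℓ⊈K) = K⁻ in ⊥-elim (clash (f≡1 K) (off K a⊆K ℓ⊈K))
  classify (one⁻ f≡0) = let (K , ℓ⊆K) = K⁺ in ⊥-elim (clash (on K ℓ⊆K) (f≡0 K))
  classify (pt⁺ p f≡p⁺) = inj₁ (p , on-ℓ p (λ K ℓ⊆K → to (f≡p⁺ K) (on K ℓ⊆K)) ,
                                distinct-from-a p (λ K → from (f≡p⁺ K)) , f≡p⁺)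
  classify (pt⁻ p f≡p⁻) = ⊥-elim (off-ℓ p (λ K → from (f≡p⁻ K))
                                          (on-ℓ′ p λ K a⊆K ℓ⊈K → to (f≡p⁻ K) (off K a⊆K ℓ⊈K)))
  classify (hy⁺ π f≡π⁺) = let (K , ℓ⊆K) = K⁺ in
    ⊥-elim (a∉ π (λ K → from (f≡π⁺ K)) (⊆-trans {S = a} {K} {π} (through-a K ℓ⊆K) (to (f≡π⁺ K) (on K ℓ⊆K))))
  classify (hy⁻ π f≡π⁻) = ⊥-elim (not-covered (proj₂ off-line) π (λ K → from (f≡π⁻ K))
                                    λ K a⊆K ℓ⊈K _ → to (f≡π⁻ K) (off K a⊆K ℓ⊈K))
  classify (ptHy⁺ p π p∉π f≡pπ⁺) = inj₂ (p , π , p⊆ℓ , distinct-from-a p (λ K → from (f≡pπ⁺ K) ∘ inj₁) ,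
                                         a∉π , p∉π , f≡pπ⁺)
    where
    a∉π : ¬ (a ⊆ π)
    a∉π = a∉ π (λ K → from (f≡pπ⁺ K) ∘ inj₂)
    -- on a k-space through ℓ, f = 1 must come from p, since the space is not inside π
    p⊆ℓ : p ⊆ ℓ
    p⊆ℓ = on-ℓ p λ K ℓ⊆K →
      [ (λ p⊆K → p⊆K) , (λ K⊆π → ⊥-elim (a∉π (⊆-trans {S = a} {K} {π} (through-a K ℓ⊆K) K⊆π))) ]′
        (to (f≡pπ⁺ K) (on K ℓ⊆K))
  classify (ptHy⁻ p π _ f≡pπ⁻) = ⊥-elim (not-covered p∉ℓ π (λ K → from (f≡pπ⁻ K) ∘ inj₂) contains)
    where
    p∉ℓ : ¬ (vec p ∈span Sub.basis ℓ)
    p∉ℓ p∈ℓ = off-ℓ p (λ K → from (f≡pπ⁻ K) ∘ inj₁) (point-⊆ p {ℓ} p∈ℓ)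
    -- on a k-space avoiding p where f = 0, the zero must come from π
    contains : ∀ K → a ⊆ K → ¬ (ℓ ⊆ K) → ¬ (vec p ∈span Sub.basis K) → K ⊆ π
    contains K a⊆K ℓ⊈K p∉K = [ (λ p⊆K → ⊥-elim (p∉K (⊆-point p {K} p⊆K))) , (λ K⊆π → K⊆π) ]′
                               (to (f≡pπ⁻ K) (off K a⊆K ℓ⊈K))

open import Data.Nat using (_≤_; _*_)

room : ∀ {k n} → 2 ≤ k → 2 * k ≤ n → 2 ℕ.+ k ≤ n
room {k} 2≤k 2k≤n = ℕₚ.≤-trans (ℕₚ.+-monoˡ-≤ k 2≤k)
  (ℕₚ.≤-trans (ℕₚ.≤-reflexive (≡.cong (k ℕ.+_) (≡.sym (ℕₚ.+-identityʳ k)))) 2k≤n)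

lemma4p5 : ∀ {q : ℕ} (F : FiniteField q) (n k : ℕ) → 2 ≤ k → 2 * k ≤ n →
    let open Geometry F n in
    (f : Sub k → Bool) → Trivial k f →
    (ℓ : Line) (a : Point) → a ⊆ ℓ →
    (∀ (K : Sub k) → a ⊆ K → (ℓ ⊆ K → f K ≡ true) × (¬ (ℓ ⊆ K) → f K ≡ false)) →
    (Σ Point λ p → (p ⊆ ℓ) × ¬ (p ≅ a) × IsPlus k f (pPlus k p))
    ⊎ (Σ Point λ p → Σ Hyperplane λ π → (p ⊆ ℓ) × ¬ (p ≅ a) × ¬ (a ⊆ π) × ¬ (p ⊆ π)
         × IsPlus k f (pπPlus k p π))
lemma4p5 F n (suc (suc k')) 2≤k 2k≤n f trivial ℓ a a⊆ℓ hyp =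
  Classification.classify F n k' (room 2≤k 2k≤n) ℓ a a⊆ℓ f hyp trivial
lemma4p5 F n (suc zero) (ℕ.s≤s ()) _ _ _ _ _ _ _
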